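{- Let $\Gamma$ be a finite graph that is locally $n\times n$ grid, and let $x,y$ be vertices at distance $2$. Then $c_2(x,y) = 2m$ for some $m\in\{2,\dots,n\}$, and: (1) If $c_2(x,y)=2n$ then $d_\Gamma(x,C)=1$ for every maximal clique $C$ containing $y$. (2) If $c_2(x,y)=2m\leq 2(n-1)$, then among the $2n$ maximal cliques $C$ containing $y$, exactly $2m$ satisfy $d_\Gamma(x,C)=1$ and the remaining $2(n-m)$ satisfy $d_\Gamma(x,C)=2$.
   Context: A graph is locally $n\times n$ grid if the induced subgraph on every vertex neighbourhood $\Gamma(x)$ is isomorphic to $K_n\square K_n$ (vertices $(i,j)$, $1\le i,j\le n$, adjacent iff they agree in exactly one coordinate). $c_2(x,y)=|\Gamma(x)\cap\Gamma(y)|$. For a vertex $x$ and a set $C$ of vertices, $d_\Gamma(x,C)=\min_{z\in C} d_\Gamma(x,z)$. -}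

module Defs where

open import Data.Nat using (ℕ; zero; suc; _<_)
open import Data.Bool using (Bool; true; false)
open import Data.Fin using (Fin)
open import Data.Fin.Subset using (Subset; _∈_; _∉_; ∣_∣)
open import Data.Vec using (tabulate)
open import Data.Bool using (_∧_)
open import Data.Product using (Σ; _×_; ∃; ∃-syntax)
open import Data.Sum using (_⊎_)
open import Data.List using (List; length)
import Data.List.Membership.Propositional as LM
open import Data.List.Relation.Unary.Unique.Propositional using (Unique)
open import Relation.Nullary using (¬_)
open import Relation.Binary.PropositionalEquality using (_≡_; _≢_)
open import Function.Bundles using (_⤖_; _⇔_; Bijection)

record Graph : Set where
  field
    N     : ℕ
    E     : Fin N → Fin N → Bool
    sym   : ∀ u v → E u v ≡ E v u
    irrefl : ∀ v → E v v ≡ false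

module _ (G : Graph) where
  open Graph G

  Vertex : Set
  Vertex = Fin N

  Adj : Vertex → Vertex → Set
  Adj u v = E u v ≡ true

  Nbhd : Vertex → Set
  Nbhd x = Σ Vertex (λ v → Adj x v)

  data Walk : Vertex → Vertex → ℕ → Set where
    here : ∀ {u} → Walk u u zero
    step : ∀ {u v w k} → Adj u v → Walk v w k → Walk u w (suc k)

  Dist : Vertex → Vertex → ℕ → Set
  Dist u v k = Walk u v k × (∀ j → j < k → ¬ Walk u v j)

  DistSet : Vertex → Subset N → ℕ → Set
  DistSet x C k = (∃[ z ] (z ∈ C × Dist x z k))
                × (∀ z j → z ∈ C → j < k → ¬ Walk x z j)

  commonNbhd : Vertex → Vertex → Subset N
  commonNbhd x y = tabulate (λ z → E x z ∧ E y z)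

  c₂ : Vertex → Vertex → ℕ
  c₂ x y = ∣ commonNbhd x y ∣

  IsClique : Subset N → Set
  IsClique C = ∀ u v → u ∈ C → v ∈ C → u ≢ v → Adj u v

  IsMaximalClique : Subset N → Set
  IsMaximalClique C = IsClique C × (∀ w → w ∉ C → ¬ IsClique (C Data.Fin.Subset.∪ Data.Fin.Subset.⁅ w ⁆))

  HasCard : (Subset N → Set) → ℕ → Set
  HasCard P k = Σ (List (Subset N)) λ L →
    length L ≡ k × Unique L × (∀ C → (C LM.∈ L) ⇔ P C)

GridAdj : (n : ℕ) → Fin n × Fin n → Fin n × Fin n → Set
GridAdj n (i Data.Product., j) (i' Data.Product., j') =
  (i ≡ i' × j ≢ j') ⊎ (i ≢ i' × j ≡ j')

LocallyGrid : (G : Graph) → ℕ → Set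
LocallyGrid G n = ∀ x → Σ ((Fin n × Fin n) ⤖ Nbhd G x) λ f →
  ∀ p q → GridAdj n p q ⇔ Adj G (Data.Product.proj₁ (Bijection.to f p))
                                 (Data.Product.proj₁ (Bijection.to f q))

module Submission where

-- Identify Γ(y) with the grid through the chart supplied by the local structure and
-- mark the points μ adjacent to x; the marks are the common neighbours, so c₂(x,y) is
-- their number.  Looking at Γ(z) for a common neighbour z, where y and x become two
-- points sharing no row and no column, the common neighbours of x and y near z are
-- exactly the two other corners of their rectangle.  Back in Γ(y) this says the marking
-- is "pinched": each mark has exactly two marked neighbours, one in its row and one in
-- its column.  Hence every row and every column carries 0 or 2 marks, and counting the
-- marks by rows and by columns gives c₂ = 2m with m rows and m columns hit, 2 ≤ m ≤ n.
-- Finally the maximal cliques through y are exactly the 2n line cliques {y} ∪ ℓ for the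
-- grid lines ℓ, and such a clique is at distance 1 from x when ℓ is hit, 2 otherwise.

open import Defs

open import Axiom.UniquenessOfIdentityProofs using (module Decidable⇒UIP)
open import Data.Bool using (Bool; true; false; _∧_; not)
import Data.Bool as Bool
open import Data.Empty using (⊥-elim)
open import Data.Fin using (Fin; zero; suc; _≟_; fromℕ<)
open import Data.Fin.Properties using (any?)
open import Data.Fin.Subset using (Subset; _∈_; _∉_; _⊆_; _∪_; ⁅_⁆; ∣_∣)
open import Data.Fin.Subset.Properties using (_∈?_; x∈p∪q⁺; x∈p∪q⁻; x∈⁅x⁆; x∈⁅y⁆⇒x≡y; ⊆-antisym)
open import Data.List using (List; length; filter; _++_)
import Data.List as List
open import Data.List.Properties using (filter-++; length-++; length-map; length-tabulate)
open import Data.List.Membership.Propositional using () renaming (_∈_ to _∈ₗ_)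
open import Data.List.Membership.Propositional.Properties
  using (∈-map⁺; ∈-map⁻; ∈-filter⁺; ∈-filter⁻; ∈-tabulate⁺; ∈-tabulate⁻; ∈-++⁺ˡ; ∈-++⁺ʳ)
open import Data.List.Relation.Unary.Unique.Propositional using (Unique)
import Data.List.Relation.Unary.Unique.Propositional.Properties as Unique
open import Data.Nat using (ℕ; zero; suc; _+_; _*_; _∸_; _≤_; _<_; z≤n; s≤s)
open import Data.Nat.Properties
  using (+-*-semiring; +-mono-≤; +-identityʳ; *-identityˡ; *-identityʳ; *-comm; *-cancelˡ-≡;
         m+n∸m≡n; suc-injective; ≤-trans; ≤-reflexive; <-irrefl; module ≤-Reasoning)
open import Data.Product using (Σ; ∃; _×_; _,_; proj₁; proj₂)
import Data.Product as Product
open import Data.Product.Properties using (≡-dec)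
open import Data.Sum using (_⊎_; inj₁; inj₂; [_,_]′)
import Data.Sum as Sum
import Data.Vec as Vec
import Data.Vec.Properties as Vec
open import Function using (_∘_)
open import Function.Bundles using (Bijection; Equivalence; mk⇔)
open import Relation.Binary.PropositionalEquality
open import Relation.Nullary using (¬_; Dec; does; yes; no; ¬?; _×-dec_; _⊎-dec_)
open import Relation.Nullary.Decidable using (map′; dec-true)

open import Algebra.Properties.Semiring.Sum +-*-semiring
  using (sum-syntax; ∑-comm; ∑-distrib-+; sum-cong-≗; *-distribˡ-sum)

𝟙 : Bool → ℕ
𝟙 true  = 1
𝟙 false = 0

𝟙≤1 : ∀ b → 𝟙 b ≤ 1
𝟙≤1 true  = s≤s z≤n
𝟙≤1 false = z≤n

𝟙-∧ : ∀ a b → 𝟙 (a ∧ b) ≡ 𝟙 a * 𝟙 b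
𝟙-∧ true  b = sym (*-identityˡ (𝟙 b))
𝟙-∧ false b = refl

𝟙-not : ∀ b → 𝟙 b + 𝟙 (not b) ≡ 1
𝟙-not true  = refl
𝟙-not false = refl

𝟙-yes : ∀ {A : Set} (d : Dec A) → A → 𝟙 (does d) ≡ 1
𝟙-yes (yes _) _ = refl
𝟙-yes (no ¬a) a = ⊥-elim (¬a a)

𝟙-yes⁻¹ : ∀ {A : Set} (d : Dec A) → 𝟙 (does d) ≡ 1 → A
𝟙-yes⁻¹ (yes a) _ = a

𝟙-false : ∀ {b} → ¬ b ≡ true → 𝟙 b ≡ 0
𝟙-false {true}  b≢true = ⊥-elim (b≢true refl)
𝟙-false {false} _      = refl

∣tabulate∣ : ∀ N (g : Fin N → Bool) → ∣ Vec.tabulate g ∣ ≡ ∑[ z < N ] 𝟙 (g z)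
∣tabulate∣ zero    g = refl
∣tabulate∣ (suc N) g with g zero
... | true  = cong suc (∣tabulate∣ N (λ z → g (suc z)))
... | false = ∣tabulate∣ N (λ z → g (suc z))

subsetOf : ∀ {N} {P : Fin N → Set} → (∀ z → Dec (P z)) → Subset N
subsetOf P? = Vec.tabulate (λ z → does (P? z))

∈subsetOf⁺ : ∀ {N} {P : Fin N → Set} (P? : ∀ z → Dec (P z)) {z} → P z → z ∈ subsetOf P?
∈subsetOf⁺ P? {z} Pz = Vec.lookup⇒[]= z _ (trans (Vec.lookup∘tabulate _ z) (dec-true (P? z) Pz))

∈subsetOf⁻ : ∀ {N} {P : Fin N → Set} (P? : ∀ z → Dec (P z)) {z} → z ∈ subsetOf P? → P z
∈subsetOf⁻ P? {z} z∈ with P? z | trans (sym (Vec.lookup∘tabulate (λ z → does (P? z)) z)) (Vec.[]=⇒lookup z∈)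
... | yes Pz | _ = Pz

length-filter-tabulate : ∀ {A : Set} {P : A → Set} (P? : ∀ a → Dec (P a)) n (g : Fin n → A) →
                         length (filter P? (List.tabulate g)) ≡ ∑[ i < n ] 𝟙 (does (P? (g i)))
length-filter-tabulate P? zero    g = refl
length-filter-tabulate P? (suc n) g with does (P? (g zero))
... | true  = cong suc (length-filter-tabulate P? n (λ i → g (suc i)))
... | false = length-filter-tabulate P? n (λ i → g (suc i))

double : ∀ k → k + k ≡ 2 * k
double k = cong (k +_) (sym (+-identityʳ k))

∑-mono-≤ : ∀ n {f g : Fin n → ℕ} → (∀ i → f i ≤ g i) → ∑[ i < n ] f i ≤ ∑[ i < n ] g i
∑-mono-≤ zero    f≤g = z≤n
∑-mono-≤ (suc n) f≤g = +-mono-≤ (f≤g zero) (∑-mono-≤ n (λ i → f≤g (suc i)))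

∑-zero : ∀ n → ∑[ i < n ] 0 ≡ 0
∑-zero zero    = refl
∑-zero (suc n) = ∑-zero n

∑-one : ∀ n → ∑[ i < n ] 1 ≡ n
∑-one zero    = refl
∑-one (suc n) = cong suc (∑-one n)

∑-complement : ∀ n (b : Fin n → Bool) → ∑[ i < n ] 𝟙 (not (b i)) ≡ n ∸ ∑[ i < n ] 𝟙 (b i)
∑-complement n b = begin
  ∑[ i < n ] 𝟙 (not (b i))                                    ≡⟨ m+n∸m≡n (∑[ i < n ] 𝟙 (b i)) _ ⟨
  ∑[ i < n ] 𝟙 (b i) + ∑[ i < n ] 𝟙 (not (b i)) ∸ ∑[ i < n ] 𝟙 (b i)
    ≡⟨ cong (_∸ ∑[ i < n ] 𝟙 (b i)) (trans (sym (∑-distrib-+ (λ i → 𝟙 (b i)) (λ i → 𝟙 (not (b i)))))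
                                           (trans (sum-cong-≗ (λ i → 𝟙-not (b i))) (∑-one n))) ⟩
  n ∸ ∑[ i < n ] 𝟙 (b i)                                      ∎
  where open ≡-Reasoning

split-saturated : ∀ {a b n} → a ≤ 1 → b ≤ n → a + b ≡ suc n → a ≡ 1 × b ≡ n
split-saturated {zero}  _ b≤n b≡1+n = ⊥-elim (<-irrefl b≡1+n (s≤s b≤n))
split-saturated {suc zero} _ _ 1+b≡1+n = refl , suc-injective 1+b≡1+n
split-saturated {suc (suc a)} (s≤s ()) _ _

∑-saturated : ∀ n (f : Fin n → ℕ) → (∀ i → f i ≤ 1) → ∑[ i < n ] f i ≡ n → ∀ i → f i ≡ 1
∑-saturated (suc n) f f≤1 ∑f≡n i = go i
  where
  tail≤n : ∑[ i < n ] f (suc i) ≤ n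
  tail≤n = ≤-trans (∑-mono-≤ n (λ i → f≤1 (suc i))) (≤-reflexive (∑-one n))
  split : f zero ≡ 1 × ∑[ i < n ] f (suc i) ≡ n
  split = split-saturated (f≤1 zero) tail≤n ∑f≡n
  go : ∀ i → f i ≡ 1
  go zero    = proj₁ split
  go (suc i) = ∑-saturated n (λ i → f (suc i)) (λ i → f≤1 (suc i)) (proj₂ split) i

δ : ∀ {n} → Fin n → Fin n → ℕ
δ a i = 𝟙 (does (i ≟ a))

δ-diag : ∀ {n} {a i : Fin n} → i ≡ a → δ a i ≡ 1
δ-diag {a = a} {i} i≡a with i ≟ a
... | yes _   = refl
... | no i≢a = ⊥-elim (i≢a i≡a)

δ-off : ∀ {n} {a i : Fin n} → ¬ i ≡ a → δ a i ≡ 0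
δ-off {a = a} {i} i≢a with i ≟ a
... | yes i≡a = ⊥-elim (i≢a i≡a)
... | no _    = refl

∑-δ : ∀ n (a : Fin n) (g : Fin n → ℕ) → ∑[ i < n ] (δ a i * g i) ≡ g a
∑-δ (suc n) zero g = begin
  δ {suc n} zero zero * g zero + ∑[ i < n ] (δ zero (suc i) * g (suc i))
    ≡⟨ cong (g zero + 0 +_) (sum-cong-≗ (λ i → cong (_* g (suc i)) (δ-off {a = zero} {suc i} λ ()))) ⟩
  g zero + 0 + ∑[ i < n ] 0
    ≡⟨ cong₂ _+_ (+-identityʳ (g zero)) (∑-zero n) ⟩
  g zero + 0
    ≡⟨ +-identityʳ (g zero) ⟩
  g zero ∎
  where open ≡-Reasoning
∑-δ (suc n) (suc a) g = ∑-δ n a (λ i → g (suc i))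

∑-δ-one : ∀ n (a : Fin n) → ∑[ i < n ] δ a i ≡ 1
∑-δ-one n a = trans (sum-cong-≗ (λ i → sym (*-identityʳ (δ a i)))) (∑-δ n a (λ _ → 1))

count-two : ∀ m (t : Fin m → Bool) (k k' : Fin m) → ¬ k' ≡ k → t k ≡ true → t k' ≡ true →
            (∀ j → t j ≡ true → j ≡ k ⊎ j ≡ k') → ∑[ j < m ] 𝟙 (t j) ≡ 2
count-two m t k k' k'≢k tk tk' only = begin
  ∑[ j < m ] 𝟙 (t j)             ≡⟨ sum-cong-≗ as-deltas ⟩
  ∑[ j < m ] (δ k j + δ k' j)    ≡⟨ ∑-distrib-+ (δ k) (δ k') ⟩
  ∑[ j < m ] δ k j + ∑[ j < m ] δ k' j ≡⟨ cong₂ _+_ (∑-δ-one m k) (∑-δ-one m k') ⟩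
  2 ∎
  where
  open ≡-Reasoning
  as-deltas : ∀ j → 𝟙 (t j) ≡ δ k j + δ k' j
  as-deltas j with j ≟ k | j ≟ k'
  ... | yes j≡k | yes j≡k' = ⊥-elim (k'≢k (trans (sym j≡k') j≡k))
  ... | yes refl | no _   = cong 𝟙 tk
  ... | no _    | yes refl = cong 𝟙 tk'
  ... | no j≢k  | no j≢k' = 𝟙-false (λ tj → [ j≢k , j≢k' ]′ (only j tj))

count-none : ∀ m (t : Fin m → Bool) → (∀ j → ¬ t j ≡ true) → ∑[ j < m ] 𝟙 (t j) ≡ 0
count-none m t none = trans (sum-cong-≗ (λ j → 𝟙-false (none j))) (∑-zero m)

∑-two-positive : ∀ n (f : Fin n → ℕ) {a b : Fin n} → ¬ a ≡ b → 1 ≤ f a → 1 ≤ f b → 2 ≤ ∑[ i < n ] f i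
∑-two-positive n f {a} {b} a≢b fa fb = begin
  2                                  ≡⟨ cong₂ _+_ (∑-δ-one n a) (∑-δ-one n b) ⟨
  ∑[ i < n ] δ a i + ∑[ i < n ] δ b i ≡⟨ ∑-distrib-+ (δ a) (δ b) ⟨
  ∑[ i < n ] (δ a i + δ b i)          ≤⟨ ∑-mono-≤ n below ⟩
  ∑[ i < n ] f i                     ∎
  where
  open ≤-Reasoning
  below : ∀ i → δ a i + δ b i ≤ f i
  below i with i ≟ a | i ≟ b
  ... | yes refl | yes refl = ⊥-elim (a≢b refl)
  ... | yes refl | no _     = ≤-trans (≤-reflexive (+-identityʳ 1)) fa
  ... | no _     | yes refl = fb
  ... | no _     | no _     = z≤n

module GridGeometry {n : ℕ} where

  Point : Set
  Point = Fin n × Fin n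

  infix 4 _~_ _≟ₚ_
  _~_ : Point → Point → Set
  _~_ = GridAdj n

  _≟ₚ_ : (p q : Point) → Dec (p ≡ q)
  _≟ₚ_ = ≡-dec _≟_ _≟_

  any-point? : {P : Point → Set} → (∀ p → Dec (P p)) → Dec (∃ P)
  any-point? P? = map′ (λ (i , j , Pij) → (i , j) , Pij) (λ ((i , j) , Pij) → i , j , Pij)
                       (any? λ i → any? λ j → P? (i , j))

  ~-irrefl : ∀ {p} → ¬ p ~ p
  ~-irrefl (inj₁ (_ , j≢j)) = j≢j refl
  ~-irrefl (inj₂ (i≢i , _)) = i≢i refl

  ~-sym : ∀ {p q} → p ~ q → q ~ p
  ~-sym (inj₁ (i≡i' , j≢j')) = inj₁ (sym i≡i' , λ e → j≢j' (sym e))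
  ~-sym (inj₂ (i≢i' , j≡j')) = inj₂ ((λ e → i≢i' (sym e)) , sym j≡j')

  ~⇒≢ : ∀ {p q} → p ~ q → ¬ p ≡ q
  ~⇒≢ p~p refl = ~-irrefl p~p

  ~-transpose : ∀ {p q} → p ~ q → Product.swap p ~ Product.swap q
  ~-transpose (inj₁ row) = inj₂ (Product.swap row)
  ~-transpose (inj₂ col) = inj₁ (Product.swap col)

  Apart : Point → Point → Set
  Apart a b = ¬ proj₁ a ≡ proj₁ b × ¬ proj₂ a ≡ proj₂ b

  nonadjacent⇒apart : ∀ {a b} → ¬ a ~ b → ¬ a ≡ b → Apart a b
  nonadjacent⇒apart {a} {b} a≁b a≢b with proj₁ a ≟ proj₁ b | proj₂ a ≟ proj₂ b
  ... | yes refl | yes refl = ⊥-elim (a≢b refl)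
  ... | yes i≡   | no j≢    = ⊥-elim (a≁b (inj₁ (i≡ , j≢)))
  ... | no i≢    | yes j≡   = ⊥-elim (a≁b (inj₂ (i≢ , j≡)))
  ... | no i≢    | no j≢    = i≢ , j≢

  apart⇒≁ : ∀ {a b} → Apart a b → ¬ a ~ b
  apart⇒≁ (i≢ , _) (inj₁ (i≡ , _)) = i≢ i≡
  apart⇒≁ (_ , j≢) (inj₂ (_ , j≡)) = j≢ j≡

  apart⇒≢ : ∀ {a b} → Apart a b → ¬ a ≡ b
  apart⇒≢ (i≢ , _) a≡b = i≢ (cong proj₁ a≡b)

  apart-sym : ∀ {a b} → Apart a b → Apart b a
  apart-sym (i≢ , j≢) = (λ e → i≢ (sym e)) , (λ e → j≢ (sym e))

  corner : Point → Point → Point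
  corner a b = proj₁ a , proj₂ b

  corner-adjacent : ∀ {a b} → Apart a b → corner a b ~ a × corner a b ~ b
  corner-adjacent (i≢ , j≢) = inj₁ (refl , λ e → j≢ (sym e)) , inj₂ (i≢ , refl)

  corners-apart : ∀ {a b} → Apart a b → Apart (corner a b) (corner b a)
  corners-apart (i≢ , j≢) = i≢ , (λ e → j≢ (sym e))

  common-neighbours : ∀ {a b q} → Apart a b → q ~ a → q ~ b → q ≡ corner a b ⊎ q ≡ corner b a
  common-neighbours (i≢ , _) (inj₁ (e , _)) (inj₁ (e' , _)) = ⊥-elim (i≢ (trans (sym e) e'))
  common-neighbours _        (inj₁ (e , _)) (inj₂ (_ , e')) = inj₁ (cong₂ _,_ e e')
  common-neighbours _        (inj₂ (_ , e)) (inj₁ (e' , _)) = inj₂ (cong₂ _,_ e' e)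
  common-neighbours (_ , j≢) (inj₂ (_ , e)) (inj₂ (_ , e')) = ⊥-elim (j≢ (trans (sym e) e'))

  SameRow SameCol : Point → Point → Set
  SameRow p q = proj₁ p ≡ proj₁ q
  SameCol p q = proj₂ p ≡ proj₂ q

  apart-neighbours : ∀ {p p₁ p₂} → p ~ p₁ → p ~ p₂ → Apart p₁ p₂ →
                     (SameRow p p₁ × SameCol p p₂) ⊎ (SameCol p p₁ × SameRow p p₂)
  apart-neighbours (inj₁ (r₁ , _)) (inj₂ (_ , c₂)) _ = inj₁ (r₁ , c₂)
  apart-neighbours (inj₂ (_ , c₁)) (inj₁ (r₂ , _)) _ = inj₂ (c₁ , r₂)
  apart-neighbours (inj₁ (r₁ , _)) (inj₁ (r₂ , _)) (i≢ , _) = ⊥-elim (i≢ (trans (sym r₁) r₂))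
  apart-neighbours (inj₂ (_ , c₁)) (inj₂ (_ , c₂)) (_ , j≢) = ⊥-elim (j≢ (trans (sym c₁) c₂))

  Line : Set
  Line = Fin n ⊎ Fin n

  OnLine : Line → Point → Set
  OnLine (inj₁ i) p = proj₁ p ≡ i
  OnLine (inj₂ j) p = proj₂ p ≡ j

  line-adjacent : ∀ ℓ {p q} → OnLine ℓ p → OnLine ℓ q → ¬ p ≡ q → p ~ q
  line-adjacent (inj₁ i) {p} {q} refl q∈ p≢q = inj₁ (sym q∈ , λ e → p≢q (cong₂ _,_ (sym q∈) e))
  line-adjacent (inj₂ j) {p} {q} refl q∈ p≢q = inj₂ ((λ e → p≢q (cong₂ _,_ e (sym q∈))) , sym q∈)

  other : 2 ≤ n → (a : Fin n) → ∃ λ b → ¬ b ≡ a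
  other (s≤s (s≤s _)) zero    = suc zero , λ ()
  other (s≤s (s≤s _)) (suc a) = zero , λ ()

  non-neighbour-on-line : 2 ≤ n → ∀ ℓ {q} → ¬ OnLine ℓ q → ∃ λ p → OnLine ℓ p × ¬ p ~ q × ¬ p ≡ q
  non-neighbour-on-line 2≤n (inj₁ i) {q} q∉ with other 2≤n (proj₂ q)
  ... | j , j≢ = (i , j) , refl , (λ { (inj₁ (e , _)) → q∉ (sym e) ; (inj₂ (_ , e)) → j≢ e })
                         , (λ e → q∉ (cong proj₁ (sym e)))
  non-neighbour-on-line 2≤n (inj₂ j) {q} q∉ with other 2≤n (proj₁ q)
  ... | i , i≢ = (i , j) , refl , (λ { (inj₁ (e , _)) → i≢ e ; (inj₂ (_ , e)) → q∉ (sym e) })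
                         , (λ e → q∉ (cong proj₂ (sym e)))

  Near : Point → Point → Set
  Near r p = r ≡ p ⊎ r ~ p

  joint-line : ∀ {p q} → p ~ q → ∃ λ ℓ → ∀ r → Near r p → Near r q → OnLine ℓ r
  joint-line {p} {q} (inj₁ (i≡ , j≢)) = inj₁ (proj₁ p) , on-row
    where
    on-row : ∀ r → Near r p → Near r q → proj₁ r ≡ proj₁ p
    on-row r (inj₁ refl) _ = refl
    on-row r _ (inj₁ refl) = sym i≡
    on-row r (inj₂ (inj₁ (e , _))) _ = e
    on-row r (inj₂ (inj₂ (r≢p , _))) (inj₂ (inj₁ (e , _))) = ⊥-elim (r≢p (trans e (sym i≡)))
    on-row r (inj₂ (inj₂ (_ , e))) (inj₂ (inj₂ (_ , e'))) = ⊥-elim (j≢ (trans (sym e) e'))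
  joint-line {p} {q} (inj₂ (i≢ , j≡)) = inj₂ (proj₂ p) , on-col
    where
    on-col : ∀ r → Near r p → Near r q → proj₂ r ≡ proj₂ p
    on-col r (inj₁ refl) _ = refl
    on-col r _ (inj₁ refl) = sym j≡
    on-col r (inj₂ (inj₂ (_ , e))) _ = e
    on-col r (inj₂ (inj₁ (_ , r≢p))) (inj₂ (inj₂ (_ , e))) = ⊥-elim (r≢p (trans e (sym j≡)))
    on-col r (inj₂ (inj₁ (e , _))) (inj₂ (inj₁ (e' , _))) = ⊥-elim (i≢ (trans (sym e) e'))

  -- Every (decidable) clique of the grid lies on a line; i₀ names a row for the empty clique.
  clique-on-line : (P : Point → Set) → (∀ p → Dec (P p)) →
                   (∀ p q → P p → P q → ¬ p ≡ q → p ~ q) → Fin n →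
                   ∃ λ ℓ → ∀ p → P p → OnLine ℓ p
  clique-on-line P P? clique i₀ with any-point? P?
  ... | no empty = inj₁ i₀ , λ p Pp → ⊥-elim (empty (p , Pp))
  ... | yes (p , Pp) with any-point? (λ q → P? q ×-dec ¬? (q ≟ₚ p))
  ...   | no singleton = inj₁ (proj₁ p) , on-row
    where
    on-row : ∀ q → P q → proj₁ q ≡ proj₁ p
    on-row q Pq with q ≟ₚ p
    ... | yes refl = refl
    ... | no q≢p   = ⊥-elim (singleton (q , Pq , q≢p))
  ...   | yes (q , Pq , q≢p) with joint-line (clique p q Pp Pq (λ e → q≢p (sym e)))
  ...     | ℓ , on-ℓ = ℓ , λ r Pr → on-ℓ r (near r Pr Pp) (near r Pr Pq)
    where
    near : ∀ r {s} → P r → P s → Near r s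
    near r {s} Pr Ps with r ≟ₚ s
    ... | yes r≡s = inj₁ r≡s
    ... | no r≢s  = inj₂ (clique r s Pr Ps r≢s)

  lines : List Line
  lines = List.tabulate inj₁ ++ List.tabulate inj₂

  ∈lines : ∀ ℓ → ℓ ∈ₗ lines
  ∈lines (inj₁ i) = ∈-++⁺ˡ (∈-tabulate⁺ i)
  ∈lines (inj₂ j) = ∈-++⁺ʳ (List.tabulate inj₁) (∈-tabulate⁺ j)

  lines-unique : Unique lines
  lines-unique = Unique.++⁺ (Unique.tabulate⁺ inj₁-injective) (Unique.tabulate⁺ inj₂-injective) disjoint
    where
    inj₁-injective : ∀ {i j : Fin n} → _≡_ {A = Line} (inj₁ i) (inj₁ j) → i ≡ j
    inj₁-injective refl = refl
    inj₂-injective : ∀ {i j : Fin n} → _≡_ {A = Line} (inj₂ i) (inj₂ j) → i ≡ j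
    inj₂-injective refl = refl
    disjoint : ∀ {ℓ} → ¬ (ℓ ∈ₗ List.tabulate inj₁ × ℓ ∈ₗ List.tabulate inj₂)
    disjoint (row , col) with ∈-tabulate⁻ {f = inj₁} row | ∈-tabulate⁻ {f = inj₂} col
    ... | _ , refl | _ , ()

  length-filter-lines : ∀ {Q : Line → Set} (Q? : ∀ ℓ → Dec (Q ℓ)) →
    length (filter Q? lines) ≡ ∑[ i < n ] 𝟙 (does (Q? (inj₁ i))) + ∑[ j < n ] 𝟙 (does (Q? (inj₂ j)))
  length-filter-lines Q? =
    trans (cong length (filter-++ Q? (List.tabulate inj₁) (List.tabulate inj₂)))
          (trans (length-++ (filter Q? (List.tabulate inj₁)))
                 (cong₂ _+_ (length-filter-tabulate Q? n inj₁) (length-filter-tabulate Q? n inj₂)))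

  length-lines : length lines ≡ n + n
  length-lines = trans (length-++ (List.tabulate {n = n} inj₁))
                       (cong₂ _+_ (length-tabulate {n = n} inj₁) (length-tabulate {n = n} inj₂))

open GridGeometry

record MarkedPair {n : ℕ} (s : Point {n} → Bool) (p : Point) : Set where
  field
    p₁ p₂   : Point
    adj₁    : p ~ p₁
    adj₂    : p ~ p₂
    apart   : Apart p₁ p₂
    marked₁ : s p₁ ≡ true
    marked₂ : s p₂ ≡ true
    only    : ∀ q → s q ≡ true → p ~ q → q ≡ p₁ ⊎ q ≡ p₂

-- A marking is pinched if every mark has such a pair of marked neighbours.  This is the
-- shape of the common neighbours of two vertices at distance 2 inside a grid neighbourhood.
Pinched : ∀ {n} → (Point {n} → Bool) → Set
Pinched s = ∀ p → s p ≡ true → MarkedPair s p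

transpose : ∀ {n} → (Point {n} → Bool) → Point {n} → Bool
transpose s = s ∘ Product.swap

pinched-transpose : ∀ {n} {s : Point {n} → Bool} → Pinched s → Pinched (transpose s)
pinched-transpose pinched p sp = record
  { p₁ = Product.swap p₁ ; p₂ = Product.swap p₂
  ; adj₁ = ~-transpose adj₁ ; adj₂ = ~-transpose adj₂
  ; apart = Product.swap apart
  ; marked₁ = marked₁ ; marked₂ = marked₂
  ; only = λ q sq p~q → Sum.map (cong Product.swap) (cong Product.swap)
                                      (only (Product.swap q) sq (~-transpose p~q))
  }
  where open MarkedPair (pinched (Product.swap p) sp)

module RowCount {n : ℕ} (s : Point {n} → Bool) (pinched : Pinched s) where

  RowHit : Fin n → Set
  RowHit i = ∃ λ j → s (i , j) ≡ true

  rowHit? : ∀ i → Dec (RowHit i)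
  rowHit? i = any? (λ j → s (i , j) Bool.≟ true)

  RowMate : Point → Set
  RowMate (i , j) = ∃ λ j' → ¬ j' ≡ j × s (i , j') ≡ true × (∀ k → s (i , k) ≡ true → k ≡ j ⊎ k ≡ j')

  -- The mate is the marked neighbour r of p in its row; the other marked neighbour c
  -- lies in p's column and so cannot be in its row.
  private
    mate-from : ∀ {p r c} → p ~ r → SameRow p r → s r ≡ true → SameCol p c →
                (∀ q → s q ≡ true → p ~ q → q ≡ r ⊎ q ≡ c) → RowMate p
    mate-from {i , j} {r} {c} p~r refl sr j≡c₂ only = proj₂ r , r₂≢j , sr , in-row
      where
      r₂≢j : ¬ proj₂ r ≡ j
      r₂≢j e = ~⇒≢ p~r (cong (i ,_) (sym e))
      in-row : ∀ k → s (i , k) ≡ true → k ≡ j ⊎ k ≡ proj₂ r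
      in-row k sk with k ≟ j
      ... | yes k≡j = inj₁ k≡j
      ... | no k≢j with only (i , k) sk (inj₁ (refl , λ e → k≢j (sym e)))
      ...   | inj₁ ik≡r = inj₂ (cong proj₂ ik≡r)
      ...   | inj₂ ik≡c = ⊥-elim (k≢j (trans (cong proj₂ ik≡c) (sym j≡c₂)))

  row-mate : ∀ p → s p ≡ true → RowMate p
  row-mate p sp = pick (apart-neighbours adj₁ adj₂ apart)
    where
    open MarkedPair (pinched p sp)
    pick : (SameRow p p₁ × SameCol p p₂) ⊎ (SameCol p p₁ × SameRow p p₂) → RowMate p
    pick (inj₁ (row₁ , col₂)) = mate-from adj₁ row₁ marked₁ col₂ only
    pick (inj₂ (col₁ , row₂)) = mate-from adj₂ row₂ marked₂ col₁ (λ q sq p~q → Sum.swap (only q sq p~q))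

  row-count : ∀ i → ∑[ j < n ] 𝟙 (s (i , j)) ≡ 2 * 𝟙 (does (rowHit? i))
  row-count i with rowHit? i
  ... | no none = count-none n (λ j → s (i , j)) (λ j sij → none (j , sij))
  ... | yes (j , sij) with row-mate (i , j) sij
  ...   | j' , j'≢j , sij' , only = count-two n (λ k → s (i , k)) j j' j'≢j sij sij' only

  hitRows : ℕ
  hitRows = ∑[ i < n ] 𝟙 (does (rowHit? i))

  marks : ℕ
  marks = ∑[ i < n ] ∑[ j < n ] 𝟙 (s (i , j))

  marks≡2*hitRows : marks ≡ 2 * hitRows
  marks≡2*hitRows = trans (sum-cong-≗ row-count) (sym (*-distribˡ-sum {n} 2 (λ i → 𝟙 (does (rowHit? i)))))

  hitRows≤n : hitRows ≤ n
  hitRows≤n = ≤-trans (∑-mono-≤ n (λ i → 𝟙≤1 (does (rowHit? i)))) (≤-reflexive (∑-one n))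

module PinchedMarking {n : ℕ} (s : Point {n} → Bool) (pinched : Pinched s) where

  module Rows = RowCount s pinched
  module Cols = RowCount (transpose s) (pinched-transpose pinched)

  Hit : Line → Set
  Hit (inj₁ i) = Rows.RowHit i
  Hit (inj₂ j) = Cols.RowHit j

  hit? : ∀ ℓ → Dec (Hit ℓ)
  hit? (inj₁ i) = Rows.rowHit? i
  hit? (inj₂ j) = Cols.rowHit? j

  hit⇒marked-point : ∀ ℓ → Hit ℓ → ∃ λ p → OnLine ℓ p × s p ≡ true
  hit⇒marked-point (inj₁ i) (j , sij) = (i , j) , refl , sij
  hit⇒marked-point (inj₂ j) (i , sij) = (i , j) , refl , sij

  marked-point⇒hit : ∀ ℓ {p} → OnLine ℓ p → s p ≡ true → Hit ℓ
  marked-point⇒hit (inj₁ i) refl sp = _ , sp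
  marked-point⇒hit (inj₂ j) refl sp = _ , sp

  m : ℕ
  m = Rows.hitRows

  marks≡2*m : Rows.marks ≡ 2 * m
  marks≡2*m = Rows.marks≡2*hitRows

  -- Counting the marks by columns instead of rows shows as many hit columns as hit rows.
  hitCols≡m : Cols.hitRows ≡ m
  hitCols≡m = *-cancelˡ-≡ Cols.hitRows m 2 (begin
    2 * Cols.hitRows ≡⟨ Cols.marks≡2*hitRows ⟨
    Cols.marks       ≡⟨ ∑-comm (λ j i → 𝟙 (s (i , j))) ⟩
    Rows.marks       ≡⟨ marks≡2*m ⟩
    2 * m            ∎)
    where open ≡-Reasoning

  m≤n : m ≤ n
  m≤n = Rows.hitRows≤n

  -- A marked point (i , j) has a column mate (i' , j), so rows i and i' are both hit.
  marked⇒2≤m : ∀ {p} → s p ≡ true → 2 ≤ m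
  marked⇒2≤m {i , j} sp with Cols.row-mate (j , i) sp
  ... | i' , i'≢i , si'j , _ =
    ∑-two-positive n (λ k → 𝟙 (does (Rows.rowHit? k))) (λ e → i'≢i (sym e))
      (≤-reflexive (sym (𝟙-yes (Rows.rowHit? i) (j , sp))))
      (≤-reflexive (sym (𝟙-yes (Rows.rowHit? i') (j , si'j))))

  -- If all n rows are hit then, as m is also the number of hit columns, every line is hit.
  m≡n⇒all-hit : m ≡ n → ∀ ℓ → Hit ℓ
  m≡n⇒all-hit m≡n (inj₁ i) =
    𝟙-yes⁻¹ (Rows.rowHit? i) (∑-saturated n _ (λ k → 𝟙≤1 (does (Rows.rowHit? k))) m≡n i)
  m≡n⇒all-hit m≡n (inj₂ j) =
    𝟙-yes⁻¹ (Cols.rowHit? j) (∑-saturated n _ (λ k → 𝟙≤1 (does (Cols.rowHit? k))) (trans hitCols≡m m≡n) j)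

has-card-enumeration : (G : Graph) {I : Set} (F : I → Subset (Graph.N G)) →
  (∀ {a b} → F a ≡ F b → a ≡ b) → (xs : List I) → Unique xs →
  (P : Subset (Graph.N G) → Set) → (∀ i → i ∈ₗ xs → P (F i)) →
  (∀ C → P C → ∃ λ i → i ∈ₗ xs × C ≡ F i) → HasCard G P (length xs)
has-card-enumeration G F F-injective xs xs-unique P sound complete =
  List.map F xs , length-map F xs , Unique.map⁺ F-injective xs-unique , λ C → mk⇔ (to C) (from C)
  where
  to : ∀ C → C ∈ₗ List.map F xs → P C
  to C C∈ with ∈-map⁻ F C∈
  ... | i , i∈ , refl = sound i i∈
  from : ∀ C → P C → C ∈ₗ List.map F xs
  from C PC with complete C PC
  ... | i , i∈ , refl = ∈-map⁺ F i∈

module Adjacency (G : Graph) where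
  open Graph G using (irrefl)

  adj-sym : ∀ {u v} → Adj G u v → Adj G v u
  adj-sym {u} {v} u~v = trans (Graph.sym G v u) u~v

  adj-irrefl : ∀ {v} → ¬ Adj G v v
  adj-irrefl {v} v~v with trans (sym (irrefl v)) v~v
  ... | ()

  adj⇒≢ : ∀ {u v} → Adj G u v → ¬ u ≡ v
  adj⇒≢ u~v refl = adj-irrefl u~v

  walk₀ : ∀ {u v} → Walk G u v 0 → u ≡ v
  walk₀ here = refl

  walk₁ : ∀ {u v} → Walk G u v 1 → Adj G u v
  walk₁ (step u~v here) = u~v

  maximal⊆clique⇒≡ : ∀ {C D} → IsMaximalClique G C → IsClique G D → C ⊆ D → C ≡ D
  maximal⊆clique⇒≡ {C} {D} (_ , maximal) D-clique C⊆D = ⊆-antisym C⊆D D⊆C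
    where
    D⊆C : D ⊆ C
    D⊆C {w} w∈D with w ∈? C
    ... | yes w∈C = w∈C
    ... | no w∉C  = ⊥-elim (maximal w w∉C (λ u v u∈ v∈ → D-clique u v (into-D u∈) (into-D v∈)))
      where
      into-D : ∀ {u} → u ∈ C ∪ ⁅ w ⁆ → u ∈ D
      into-D {u} u∈ with x∈p∪q⁻ C ⁅ w ⁆ u∈
      ... | inj₁ u∈C = C⊆D u∈C
      ... | inj₂ u∈w = subst (_∈ D) (sym (x∈⁅y⁆⇒x≡y w u∈w)) w∈D

module Chart (G : Graph) (n : ℕ) (locally-grid : LocallyGrid G n) where
  open Graph G using (N; E)
  open Adjacency G

  chart : Vertex G → Point {n} → Vertex G
  chart v p = proj₁ (Bijection.to (proj₁ (locally-grid v)) p)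

  chart-adj : ∀ v p → Adj G v (chart v p)
  chart-adj v p = proj₂ (Bijection.to (proj₁ (locally-grid v)) p)

  chart-injective : ∀ v {p q} → chart v p ≡ chart v q → p ≡ q
  chart-injective v {p} {q} e = Bijection.injective (proj₁ (locally-grid v)) (neighbour≡ e)
    where
    neighbour≡ : ∀ {a b} {va : Adj G v a} {vb : Adj G v b} → a ≡ b → _≡_ {A = Nbhd G v} (a , va) (b , vb)
    neighbour≡ {va = va} {vb} refl = cong (_ ,_) (Decidable⇒UIP.≡-irrelevant Bool._≟_ va vb)

  chart-onto : ∀ v w → Adj G v w → ∃ λ p → chart v p ≡ w
  chart-onto v w v~w = Product.map₂ (cong proj₁) (Bijection.strictlySurjective (proj₁ (locally-grid v)) (w , v~w))

  chart-adjacent : ∀ v {p q} → p ~ q → Adj G (chart v p) (chart v q)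
  chart-adjacent v {p} {q} = Equivalence.to (proj₂ (locally-grid v) p q)

  chart-adjacent⁻¹ : ∀ v {p q} → Adj G (chart v p) (chart v q) → p ~ q
  chart-adjacent⁻¹ v {p} {q} = Equivalence.from (proj₂ (locally-grid v) p q)

  chart≢centre : ∀ v p → ¬ chart v p ≡ v
  chart≢centre v p e = adj⇒≢ (chart-adj v p) (sym e)

  neighbourhood-indicator : ∀ v z → 𝟙 (E v z) ≡ ∑[ i < n ] ∑[ j < n ] δ (chart v (i , j)) z
  neighbourhood-indicator v z with E v z in v~z
  ... | true with chart-onto v z v~z
  ...   | (a , b) , refl = sym (begin
    ∑[ i < n ] ∑[ j < n ] δ (chart v (i , j)) (chart v (a , b))
      ≡⟨ sum-cong-≗ (λ i → sum-cong-≗ (λ j → δ-chart i j)) ⟩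
    ∑[ i < n ] ∑[ j < n ] (δ a i * δ b j)
      ≡⟨ sum-cong-≗ (λ i → *-distribˡ-sum {n} (δ a i) (δ b)) ⟨
    ∑[ i < n ] (δ a i * ∑[ j < n ] δ b j)
      ≡⟨ sum-cong-≗ (λ i → cong (δ a i *_) (∑-δ-one n b)) ⟩
    ∑[ i < n ] (δ a i * 1)
      ≡⟨ ∑-δ n a (λ _ → 1) ⟩
    1 ∎)
    where
    open ≡-Reasoning
    δ-chart : ∀ i j → δ (chart v (i , j)) (chart v (a , b)) ≡ δ a i * δ b j
    δ-chart i j with i ≟ a | j ≟ b
    ... | yes refl | yes refl = δ-diag {a = chart v (a , b)} refl
    ... | no i≢a   | _        = δ-off (λ e → i≢a (cong proj₁ (chart-injective v (sym e))))
    ... | yes refl | no j≢b   = δ-off (λ e → j≢b (cong proj₂ (chart-injective v (sym e))))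
  neighbourhood-indicator v z | false =
    sym (trans (sum-cong-≗ (λ i → trans (sum-cong-≗ (λ j → δ-off (not-neighbour i j))) (∑-zero n))) (∑-zero n))
    where
    not-neighbour : ∀ i j → ¬ z ≡ chart v (i , j)
    not-neighbour i j refl with trans (sym v~z) (chart-adj v (i , j))
    ... | ()

  ∑-over-neighbourhood : ∀ v (f : Vertex G → ℕ) →
                         ∑[ z < N ] (f z * 𝟙 (E v z)) ≡ ∑[ i < n ] ∑[ j < n ] f (chart v (i , j))
  ∑-over-neighbourhood v f = begin
    ∑[ z < N ] (f z * 𝟙 (E v z))
      ≡⟨ sum-cong-≗ (λ z → cong (f z *_) (neighbourhood-indicator v z)) ⟩
    ∑[ z < N ] (f z * ∑[ i < n ] ∑[ j < n ] δ (c i j) z)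
      ≡⟨ sum-cong-≗ (λ z → trans (*-distribˡ-sum {n} (f z) (λ i → ∑[ j < n ] δ (c i j) z))
                                 (sum-cong-≗ (λ i → *-distribˡ-sum {n} (f z) (λ j → δ (c i j) z)))) ⟩
    ∑[ z < N ] ∑[ i < n ] ∑[ j < n ] (f z * δ (c i j) z)
      ≡⟨ ∑-comm (λ z i → ∑[ j < n ] (f z * δ (c i j) z)) ⟩
    ∑[ i < n ] ∑[ z < N ] ∑[ j < n ] (f z * δ (c i j) z)
      ≡⟨ sum-cong-≗ (λ i → ∑-comm (λ z j → f z * δ (c i j) z)) ⟩
    ∑[ i < n ] ∑[ j < n ] ∑[ z < N ] (f z * δ (c i j) z)
      ≡⟨ sum-cong-≗ (λ i → sum-cong-≗ (λ j → trans (sum-cong-≗ (λ z → *-comm (f z) _)) (∑-δ N (c i j) f))) ⟩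
    ∑[ i < n ] ∑[ j < n ] f (c i j) ∎
    where
    open ≡-Reasoning
    c : Fin n → Fin n → Vertex G
    c i j = chart v (i , j)

module LineCliques (G : Graph) (n : ℕ) (locally-grid : LocallyGrid G n) (y : Vertex G) where
  open Graph G using (N)
  open Adjacency G
  open Chart G n locally-grid

  onLine? : ∀ ℓ p → Dec (OnLine {n} ℓ p)
  onLine? (inj₁ i) p = proj₁ p ≟ i
  onLine? (inj₂ j) p = proj₂ p ≟ j

  InLine : Line {n} → Vertex G → Set
  InLine ℓ z = z ≡ y ⊎ ∃ λ p → OnLine ℓ p × chart y p ≡ z

  inLine? : ∀ ℓ z → Dec (InLine ℓ z)
  inLine? ℓ z = (z ≟ y) ⊎-dec any-point? (λ p → onLine? ℓ p ×-dec (chart y p ≟ z))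

  lineClique : Line {n} → Subset N
  lineClique ℓ = subsetOf (inLine? ℓ)

  y∈lineClique : ∀ ℓ → y ∈ lineClique ℓ
  y∈lineClique ℓ = ∈subsetOf⁺ (inLine? ℓ) (inj₁ refl)

  chart∈lineClique : ∀ ℓ {p} → OnLine ℓ p → chart y p ∈ lineClique ℓ
  chart∈lineClique ℓ {p} p∈ℓ = ∈subsetOf⁺ (inLine? ℓ) (inj₂ (p , p∈ℓ , refl))

  lineClique-clique : ∀ ℓ → IsClique G (lineClique ℓ)
  lineClique-clique ℓ u v u∈ v∈ u≢v with ∈subsetOf⁻ (inLine? ℓ) u∈ | ∈subsetOf⁻ (inLine? ℓ) v∈
  ... | inj₁ refl | inj₁ refl = ⊥-elim (u≢v refl)
  ... | inj₁ refl | inj₂ (q , _ , refl) = chart-adj y q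
  ... | inj₂ (p , _ , refl) | inj₁ refl = adj-sym (chart-adj y p)
  ... | inj₂ (p , p∈ℓ , refl) | inj₂ (q , q∈ℓ , refl) =
    chart-adjacent y (line-adjacent ℓ p∈ℓ q∈ℓ (λ p≡q → u≢v (cong (chart y) p≡q)))

  -- A vertex w outside the line clique of ℓ is a neighbour chart y q of y with q off ℓ;
  -- a point of ℓ non-adjacent to q then obstructs extending the clique by w.
  lineClique-maximal : 2 ≤ n → ∀ ℓ → IsMaximalClique G (lineClique ℓ)
  lineClique-maximal 2≤n ℓ = lineClique-clique ℓ , extend
    where
    extend : ∀ w → w ∉ lineClique ℓ → ¬ IsClique G (lineClique ℓ ∪ ⁅ w ⁆)
    extend w w∉ clique with chart-onto y w (clique y w (x∈p∪q⁺ (inj₁ (y∈lineClique ℓ))) w∈ y≢w)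
      where
      w∈ : w ∈ lineClique ℓ ∪ ⁅ w ⁆
      w∈ = x∈p∪q⁺ (inj₂ (x∈⁅x⁆ w))
      y≢w : ¬ y ≡ w
      y≢w y≡w = w∉ (subst (_∈ lineClique ℓ) y≡w (y∈lineClique ℓ))
    ... | q , refl with non-neighbour-on-line 2≤n ℓ {q} (λ q∈ℓ → w∉ (chart∈lineClique ℓ q∈ℓ))
    ...   | p , p∈ℓ , p≁q , p≢q =
      p≁q (chart-adjacent⁻¹ y (clique (chart y p) (chart y q)
             (x∈p∪q⁺ (inj₁ (chart∈lineClique ℓ p∈ℓ))) (x∈p∪q⁺ (inj₂ (x∈⁅x⁆ (chart y q))))
             (λ e → p≢q (chart-injective y e))))

  -- Conversely, the points of Γ(y) in a clique C through y form a grid clique, which lies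
  -- on a line ℓ; so C is contained in, and by maximality equal to, the line clique of ℓ.
  maximal-clique⇒line : 2 ≤ n → ∀ C → IsMaximalClique G C → y ∈ C → ∃ λ ℓ → C ≡ lineClique ℓ
  maximal-clique⇒line 2≤n C maximal y∈C =
    ℓ , maximal⊆clique⇒≡ maximal (lineClique-clique ℓ) C⊆ℓ
    where
    clique : IsClique G C
    clique = proj₁ maximal
    grid-clique : ∀ p q → chart y p ∈ C → chart y q ∈ C → ¬ p ≡ q → p ~ q
    grid-clique p q p∈C q∈C p≢q =
      chart-adjacent⁻¹ y (clique (chart y p) (chart y q) p∈C q∈C (λ e → p≢q (chart-injective y e)))
    line : ∃ λ ℓ → ∀ p → chart y p ∈ C → OnLine ℓ p
    line = clique-on-line (λ p → chart y p ∈ C) (λ p → chart y p ∈? C) grid-clique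
                          (fromℕ< (≤-trans (s≤s z≤n) 2≤n))
    ℓ : Line
    ℓ = proj₁ line
    C⊆ℓ : C ⊆ lineClique ℓ
    C⊆ℓ {w} w∈C with w ≟ y
    ... | yes refl = y∈lineClique ℓ
    ... | no w≢y with chart-onto y w (clique y w y∈C w∈C (λ e → w≢y (sym e)))
    ...   | p , refl = chart∈lineClique ℓ (proj₂ line p w∈C)

  private
    transfer : ∀ ℓ ℓ′ → lineClique ℓ ≡ lineClique ℓ′ → ∀ p → OnLine ℓ p → OnLine ℓ′ p
    transfer ℓ ℓ′ e p p∈ℓ with ∈subsetOf⁻ (inLine? ℓ′) (subst (chart y p ∈_) e (chart∈lineClique ℓ p∈ℓ))
    ... | inj₁ p↦y = ⊥-elim (chart≢centre y p p↦y)
    ... | inj₂ (q , q∈ℓ′ , q↦p) = subst (OnLine ℓ′) (chart-injective y q↦p) q∈ℓ′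

  lineClique-injective : 2 ≤ n → ∀ {ℓ ℓ′} → lineClique ℓ ≡ lineClique ℓ′ → ℓ ≡ ℓ′
  lineClique-injective 2≤n {inj₁ i} {inj₁ i′} e = cong inj₁ (transfer (inj₁ i) (inj₁ i′) e (i , i) refl)
  lineClique-injective 2≤n {inj₂ j} {inj₂ j′} e = cong inj₂ (transfer (inj₂ j) (inj₂ j′) e (j , j) refl)
  lineClique-injective 2≤n {inj₁ i} {inj₂ j} e with other 2≤n j
  ... | k , k≢j = ⊥-elim (k≢j (transfer (inj₁ i) (inj₂ j) e (i , k) refl))
  lineClique-injective 2≤n {inj₂ j} {inj₁ i} e with other 2≤n i
  ... | k , k≢i = ⊥-elim (k≢i (transfer (inj₂ j) (inj₁ i) e (k , j) refl))

module DistanceTwo (G : Graph) (n : ℕ) (locally-grid : LocallyGrid G n)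
                   (x y : Vertex G) (d : Dist G x y 2) where
  open Graph G using (N; E)
  open Adjacency G
  open Chart G n locally-grid

  x≢y : ¬ x ≡ y
  x≢y x≡y = proj₂ d 0 (s≤s z≤n) (subst (λ t → Walk G x t 0) x≡y here)

  x≁y : ¬ Adj G x y
  x≁y x~y = proj₂ d 1 (s≤s (s≤s z≤n)) (step x~y here)

  record LocalPair (z : Vertex G) : Set where
    field
      w₁ w₂      : Vertex G
      z~w₁       : Adj G z w₁
      z~w₂       : Adj G z w₂
      x~w₁       : Adj G x w₁
      x~w₂       : Adj G x w₂
      y~w₁       : Adj G y w₁
      y~w₂       : Adj G y w₂
      w₁≁w₂      : ¬ Adj G w₁ w₂
      w₁≢w₂      : ¬ w₁ ≡ w₂
      only       : ∀ w → Adj G z w → Adj G x w → Adj G y w → w ≡ w₁ ⊎ w ≡ w₂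

  -- In the chart of z, y and x sit at apart points a and b (as x ≁ y and x ≢ y); the
  -- common neighbours are the two corners of the rectangle spanned by a and b.
  local-pair : ∀ z → Adj G y z → Adj G x z → LocalPair z
  local-pair z y~z x~z = record
    { w₁ = chart z q₁ ; w₂ = chart z q₂
    ; z~w₁ = chart-adj z q₁ ; z~w₂ = chart-adj z q₂
    ; x~w₁ = near-x (proj₂ (corner-adjacent ab-apart))
    ; x~w₂ = near-x (proj₁ (corner-adjacent (apart-sym ab-apart)))
    ; y~w₁ = near-y (proj₁ (corner-adjacent ab-apart))
    ; y~w₂ = near-y (proj₂ (corner-adjacent (apart-sym ab-apart)))
    ; w₁≁w₂ = λ w₁~w₂ → apart⇒≁ (corners-apart ab-apart) (chart-adjacent⁻¹ z w₁~w₂)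
    ; w₁≢w₂ = λ w₁≡w₂ → apart⇒≢ (corners-apart ab-apart) (chart-injective z w₁≡w₂)
    ; only = only
    }
    where
    a b : Point
    a = proj₁ (chart-onto z y (adj-sym y~z))
    b = proj₁ (chart-onto z x (adj-sym x~z))
    a↦y : chart z a ≡ y
    a↦y = proj₂ (chart-onto z y (adj-sym y~z))
    b↦x : chart z b ≡ x
    b↦x = proj₂ (chart-onto z x (adj-sym x~z))
    ab-apart : Apart a b
    ab-apart = nonadjacent⇒apart
      (λ a~b → x≁y (adj-sym (subst₂ (Adj G) a↦y b↦x (chart-adjacent z a~b))))
      (λ a≡b → x≢y (trans (sym b↦x) (trans (cong (chart z) (sym a≡b)) a↦y)))
    q₁ q₂ : Point
    q₁ = corner a b
    q₂ = corner b a
    near-x : ∀ {q} → q ~ b → Adj G x (chart z q)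
    near-x q~b = subst (λ v → Adj G v _) b↦x (chart-adjacent z (~-sym q~b))
    near-y : ∀ {q} → q ~ a → Adj G y (chart z q)
    near-y q~a = subst (λ v → Adj G v _) a↦y (chart-adjacent z (~-sym q~a))
    only : ∀ w → Adj G z w → Adj G x w → Adj G y w → w ≡ chart z q₁ ⊎ w ≡ chart z q₂
    only w z~w x~w y~w with chart-onto z w z~w
    ... | q , refl = Sum.map (cong (chart z)) (cong (chart z))
      (common-neighbours ab-apart
        (~-sym (chart-adjacent⁻¹ z (subst (λ v → Adj G v _) (sym a↦y) y~w)))
        (~-sym (chart-adjacent⁻¹ z (subst (λ v → Adj G v _) (sym b↦x) x~w))))

  -- μ marks the points of the chart of Γ(y) that are adjacent to x: the common neighbours.
  μ : Point {n} → Bool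
  μ p = E x (chart y p)

  -- Transporting the local pair at z = chart y p into the chart of y shows that μ is pinched.
  μ-pinched : Pinched μ
  μ-pinched p x~z = record
    { p₁ = p₁ ; p₂ = p₂
    ; adj₁ = chart-adjacent⁻¹ y (subst (Adj G z) (sym p₁↦w₁) z~w₁)
    ; adj₂ = chart-adjacent⁻¹ y (subst (Adj G z) (sym p₂↦w₂) z~w₂)
    ; apart = nonadjacent⇒apart
        (λ p₁~p₂ → w₁≁w₂ (subst₂ (Adj G) p₁↦w₁ p₂↦w₂ (chart-adjacent y p₁~p₂)))
        (λ p₁≡p₂ → w₁≢w₂ (trans (sym p₁↦w₁) (trans (cong (chart y) p₁≡p₂) p₂↦w₂)))
    ; marked₁ = subst (Adj G x) (sym p₁↦w₁) x~w₁
    ; marked₂ = subst (Adj G x) (sym p₂↦w₂) x~w₂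
    ; only = λ q x~q p~q → Sum.map (λ e → chart-injective y (trans e (sym p₁↦w₁)))
                                        (λ e → chart-injective y (trans e (sym p₂↦w₂)))
                                        (only (chart y q) (chart-adjacent y p~q) x~q (chart-adj y q))
    }
    where
    z : Vertex G
    z = chart y p
    open LocalPair (local-pair z (chart-adj y p) x~z)
    p₁ p₂ : Point
    p₁ = proj₁ (chart-onto y w₁ y~w₁)
    p₂ = proj₁ (chart-onto y w₂ y~w₂)
    p₁↦w₁ : chart y p₁ ≡ w₁
    p₁↦w₁ = proj₂ (chart-onto y w₁ y~w₁)
    p₂↦w₂ : chart y p₂ ≡ w₂
    p₂↦w₂ = proj₂ (chart-onto y w₂ y~w₂)

  open PinchedMarking μ μ-pinched public
  open LineCliques G n locally-grid y

  -- c₂(x,y) counts the common neighbours, i.e. the marks of μ in the chart of Γ(y).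
  c₂≡2m : c₂ G x y ≡ 2 * m
  c₂≡2m = begin
    c₂ G x y                             ≡⟨ ∣tabulate∣ N (λ z → E x z ∧ E y z) ⟩
    ∑[ z < N ] 𝟙 (E x z ∧ E y z)         ≡⟨ sum-cong-≗ (λ z → 𝟙-∧ (E x z) (E y z)) ⟩
    ∑[ z < N ] (𝟙 (E x z) * 𝟙 (E y z))   ≡⟨ ∑-over-neighbourhood y (𝟙 ∘ E x) ⟩
    Rows.marks                           ≡⟨ marks≡2*m ⟩
    2 * m                                ∎
    where open ≡-Reasoning

  -- The middle vertex of a walk x ~ v ~ y is a common neighbour, so μ has a mark.
  2≤m : 2 ≤ m
  2≤m with proj₁ d
  ... | step x~v (step v~y here) with chart-onto y _ (adj-sym v~y)
  ...   | p , refl = marked⇒2≤m x~v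

  private
    x∉lineClique : ∀ ℓ → x ∉ lineClique ℓ
    x∉lineClique ℓ x∈ with ∈subsetOf⁻ (inLine? ℓ) x∈
    ... | inj₁ x≡y = x≢y x≡y
    ... | inj₂ (p , _ , refl) = x≁y (adj-sym (chart-adj y p))

    no-walk₀ : ∀ ℓ z → z ∈ lineClique ℓ → ¬ Walk G x z 0
    no-walk₀ ℓ z z∈ w = x∉lineClique ℓ (subst (_∈ lineClique ℓ) (sym (walk₀ w)) z∈)

    adjacent⇒hit : ∀ ℓ z → z ∈ lineClique ℓ → Adj G x z → Hit ℓ
    adjacent⇒hit ℓ z z∈ x~z with ∈subsetOf⁻ (inLine? ℓ) z∈
    ... | inj₁ refl = ⊥-elim (x≁y x~z)
    ... | inj₂ (p , p∈ℓ , refl) = marked-point⇒hit ℓ p∈ℓ x~z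

    below-one : ∀ ℓ z j → z ∈ lineClique ℓ → j < 1 → ¬ Walk G x z j
    below-one ℓ z zero    z∈ _ = no-walk₀ ℓ z z∈
    below-one ℓ z (suc j) z∈ (s≤s ())

    below-two : ∀ ℓ → ¬ Hit ℓ → ∀ z j → z ∈ lineClique ℓ → j < 2 → ¬ Walk G x z j
    below-two ℓ _    z zero       z∈ _ = no-walk₀ ℓ z z∈
    below-two ℓ ¬hit z (suc zero) z∈ _ = λ w → ¬hit (adjacent⇒hit ℓ z z∈ (walk₁ w))
    below-two ℓ _    z (suc (suc j)) z∈ (s≤s (s≤s ()))

  hit⇒distance-one : ∀ ℓ → Hit ℓ → DistSet G x (lineClique ℓ) 1
  hit⇒distance-one ℓ hit with hit⇒marked-point ℓ hit
  ... | p , p∈ℓ , x~p = (chart y p , z∈ , step x~p here , λ j → below-one ℓ _ j z∈) , below-one ℓ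
    where
    z∈ : chart y p ∈ lineClique ℓ
    z∈ = chart∈lineClique ℓ p∈ℓ

  distance-one⇒hit : ∀ ℓ → DistSet G x (lineClique ℓ) 1 → Hit ℓ
  distance-one⇒hit ℓ ((z , z∈ , w , _) , _) = adjacent⇒hit ℓ z z∈ (walk₁ w)

  unhit⇒distance-two : ∀ ℓ → ¬ Hit ℓ → DistSet G x (lineClique ℓ) 2
  unhit⇒distance-two ℓ ¬hit = (y , y∈lineClique ℓ , d) , below-two ℓ ¬hit

  distance-two⇒unhit : ∀ ℓ → DistSet G x (lineClique ℓ) 2 → ¬ Hit ℓ
  distance-two⇒unhit ℓ (_ , below) hit with hit⇒distance-one ℓ hit
  ... | (z , z∈ , w , _) , _ = below z 1 z∈ (s≤s (s≤s z≤n)) w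

  2≤n : 2 ≤ n
  2≤n = ≤-trans 2≤m m≤n

  classify : ∀ C → IsMaximalClique G C → y ∈ C → ∃ λ ℓ → ℓ ∈ₗ lines {n} × C ≡ lineClique ℓ
  classify C maximal y∈C with maximal-clique⇒line 2≤n C maximal y∈C
  ... | ℓ , C≡ℓ = ℓ , ∈lines ℓ , C≡ℓ

  cliques-through-y : HasCard G (λ C → IsMaximalClique G C × y ∈ C) (2 * n)
  cliques-through-y = subst (HasCard G _) (trans (length-lines {n}) (double n))
    (has-card-enumeration G lineClique (lineClique-injective 2≤n) (lines {n}) (lines-unique {n}) _
      (λ ℓ _ → lineClique-maximal 2≤n ℓ , y∈lineClique ℓ)
      (λ C (maximal , y∈C) → classify C maximal y∈C))

  cliques-on-lines : ∀ {Q : Line → Set} (Q? : ∀ ℓ → Dec (Q ℓ)) (R : Subset N → Set) →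
    (∀ ℓ → Q ℓ → R (lineClique ℓ)) → (∀ ℓ → R (lineClique ℓ) → Q ℓ) →
    HasCard G (λ C → IsMaximalClique G C × y ∈ C × R C) (length (filter Q? (lines {n})))
  cliques-on-lines Q? R Q⇒R R⇒Q =
    has-card-enumeration G lineClique (lineClique-injective 2≤n) (filter Q? (lines {n}))
      (Unique.filter⁺ Q? (lines-unique {n})) _ sound complete
    where
    sound : ∀ ℓ → ℓ ∈ₗ filter Q? (lines {n}) → IsMaximalClique G (lineClique ℓ) × y ∈ lineClique ℓ × R (lineClique ℓ)
    sound ℓ ℓ∈ = lineClique-maximal 2≤n ℓ , y∈lineClique ℓ , Q⇒R ℓ (proj₂ (∈-filter⁻ Q? {xs = lines {n}} ℓ∈))
    complete : ∀ C → IsMaximalClique G C × y ∈ C × R C → ∃ λ ℓ → ℓ ∈ₗ filter Q? (lines {n}) × C ≡ lineClique ℓ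
    complete C (maximal , y∈C , RC) with classify C maximal y∈C
    ... | ℓ , ℓ∈ , refl = ℓ , ∈-filter⁺ Q? ℓ∈ (R⇒Q ℓ RC) , refl

  cliques-at-distance-one : HasCard G (λ C → IsMaximalClique G C × y ∈ C × DistSet G x C 1) (2 * m)
  cliques-at-distance-one =
    subst (HasCard G _) (trans (length-filter-lines hit?) (trans (cong (m +_) hitCols≡m) (double m)))
      (cliques-on-lines hit? (λ C → DistSet G x C 1) hit⇒distance-one distance-one⇒hit)

  cliques-at-distance-two : HasCard G (λ C → IsMaximalClique G C × y ∈ C × DistSet G x C 2) (2 * (n ∸ m))
  cliques-at-distance-two =
    subst (HasCard G _) (trans (length-filter-lines (¬? ∘ hit?)) unhit-count)
      (cliques-on-lines (¬? ∘ hit?) (λ C → DistSet G x C 2) unhit⇒distance-two distance-two⇒unhit)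
    where
    unhit-count : ∑[ i < n ] 𝟙 (not (does (hit? (inj₁ i)))) + ∑[ j < n ] 𝟙 (not (does (hit? (inj₂ j))))
                ≡ 2 * (n ∸ m)
    unhit-count = trans (cong₂ _+_ (∑-complement n (λ i → does (hit? (inj₁ i))))
                                   (trans (∑-complement n (λ j → does (hit? (inj₂ j)))) (cong (n ∸_) hitCols≡m)))
                        (double (n ∸ m))

  -- If c₂(x,y) = 2n then all n rows are hit, hence every line and every clique through y.
  c₂-maximal : c₂ G x y ≡ 2 * n → ∀ C → IsMaximalClique G C → y ∈ C → DistSet G x C 1
  c₂-maximal c₂≡2n C maximal y∈C with classify C maximal y∈C
  ... | ℓ , _ , refl = hit⇒distance-one ℓ (m≡n⇒all-hit (*-cancelˡ-≡ m n 2 (trans (sym c₂≡2m) c₂≡2n)) ℓ)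

-- Lemma 4.3.  Let Γ be locally n × n grid and d(x,y) = 2.  Then c₂(x,y) = 2m with
-- 2 ≤ m ≤ n; if c₂(x,y) = 2n every maximal clique through y is at distance 1 from x;
-- and of the 2n maximal cliques through y exactly 2m are at distance 1 and the
-- remaining 2(n − m) at distance 2 from x.  (The counts hold without the hypothesis
-- 2m ≤ 2(n − 1) of part (2).)
lemma4p3 : (G : Graph) (n : ℕ) → LocallyGrid G n →
    (x y : Vertex G) → Dist G x y 2 →
    Σ ℕ λ m → (2 ≤ m × m ≤ n × c₂ G x y ≡ 2 * m)
      × (c₂ G x y ≡ 2 * n →
           ∀ C → IsMaximalClique G C → y ∈ C → DistSet G x C 1)
      × (2 * m ≤ 2 * (n ∸ 1) →
           HasCard G (λ C → IsMaximalClique G C × y ∈ C) (2 * n)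
           × HasCard G (λ C → IsMaximalClique G C × y ∈ C × DistSet G x C 1) (2 * m)
           × HasCard G (λ C → IsMaximalClique G C × y ∈ C × DistSet G x C 2) (2 * (n ∸ m)))
lemma4p3 G n locally-grid x y d =
  m , (2≤m , m≤n , c₂≡2m) , c₂-maximal ,
  λ _ → cliques-through-y , cliques-at-distance-one , cliques-at-distance-two
  where open DistanceTwo G n locally-grid x y d
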